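{- Let $G$ be a di-cograph and $(T',t)$ its cotree. Then $G$ contains one of the triangles $F_1$, $F_5$, $F_8$ as an induced subgraph if and only if there are two inner vertices $v,w$ of $T'$ with $v\succ_{T'} w$ such that either (i) $t(v)=0\neq t(w)$, or (ii) $t(v)=\overrightarrow{1}$, $t(w)=1$, and $w$ is located in a subtree rooted at a child of $v$ different from the right-most child of $v$.
   Context: A di-cograph is a digraph obtained from single vertices by repeated disjoint union, series composition (disjoint union plus all arcs in both directions between the parts) and order composition (disjoint union plus all arcs from the first part to the second). Its cotree is the unique ordered rooted phylogenetic tree $(T',t)$ (root degree $\ge2$, other inner vertices degree $\ge3$, children of each vertex ordered left to right) with leaf set $V(G)$ and inner-vertex labels $t\in\{0,1,\overrightarrow{1}\}$, adjacent inner vertices labeled differently, such that for distinct vertices $x,y$: $t(\operatorname{lca}(x,y))=0$ if neither $(x,y)$ nor $(y,x)$ is an arc, $1$ if both are arcs, and $\overrightarrow{1}$ otherwise, in which case the arc is $(x,y)$ when $x$ is placed to the left of $y$. $v\succ_{T'}w$ means $v$ is a proper ancestor of $w$. On vertex set $\{x,y,z\}$: $F_1$ has the single arc $(x,y)$; $F_5$ has exactly the arcs $(x,y),(y,x)$; $F_8$ has exactly the arcs $(x,y),(y,x),(x,z),(y,z)$. -}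

module Defs where

open import Data.Nat using (ℕ; zero; suc; _<_; _≤_)
open import Data.Fin using (Fin)
open import Data.Bool using (Bool; true; false)
open import Data.List using (List; []; _∷_; _++_; [_]; length)
open import Data.Maybe using (Maybe; just; nothing)
open import Data.Product using (_×_; Σ; ∃; ∃-syntax; _,_)
open import Data.Sum using (_⊎_)
open import Relation.Binary.PropositionalEquality using (_≡_; _≢_)
open import Relation.Nullary using (¬_)
open import Function.Definitions using (Injective)

-- Digraphs on the vertex set Fin n, given by their arc relation.
-- Only arcs between distinct vertices are ever consulted (no loops).

record Digraph (n : ℕ) : Set where
  field
    arc : Fin n → Fin n → Bool

open Digraph public

-- An (abstract) digraph on 3 vertices x = 0, y = 1, z = 2.
Digraph3 : Set
Digraph3 = Fin 3 → Fin 3 → Bool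

ContainsInduced : ∀ {n} → Digraph n → Digraph3 → Set
ContainsInduced {n} G F =
  ∃[ f ] (Injective _≡_ _≡_ f ×
          (∀ (u v : Fin 3) → u ≢ v → arc G (f u) (f v) ≡ F u v))

F₁ : Digraph3
F₁ Fin.zero (Fin.suc Fin.zero) = true
F₁ _ _ = false

F₅ : Digraph3
F₅ Fin.zero (Fin.suc Fin.zero) = true
F₅ (Fin.suc Fin.zero) Fin.zero = true
F₅ _ _ = false

F₈ : Digraph3
F₈ Fin.zero (Fin.suc Fin.zero) = true
F₈ (Fin.suc Fin.zero) Fin.zero = true
F₈ Fin.zero (Fin.suc (Fin.suc Fin.zero)) = true
F₈ (Fin.suc Fin.zero) (Fin.suc (Fin.suc Fin.zero)) = true
F₈ _ _ = false

-- Ordered rooted trees with leaves labelled by vertices and inner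
-- vertices labelled by 0, 1, →1.  Children are ordered left to right
-- by their position in the list.

data Label : Set where
  lab0 lab1 lab1→ : Label

data Tree (V : Set) : Set where
  leaf : V → Tree V
  node : Label → List (Tree V) → Tree V

-- Vertices of a tree are addressed by paths: lists of child indices
-- (0 = left-most child) from the root.
Path : Set
Path = List ℕ

mutual
  subtree : ∀ {V} → Tree V → Path → Maybe (Tree V)
  subtree t [] = just t
  subtree (leaf _) (_ ∷ _) = nothing
  subtree (node _ ts) (i ∷ p) = subtreeL ts i p

  subtreeL : ∀ {V} → List (Tree V) → ℕ → Path → Maybe (Tree V)
  subtreeL [] _ _ = nothing
  subtreeL (t ∷ _) zero p = subtree t p
  subtreeL (_ ∷ ts) (suc i) p = subtreeL ts i p

InnerAt : ∀ {V} → Tree V → Path → Label → List (Tree V) → Set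
InnerAt T p l ts = subtree T p ≡ just (node l ts)

LeafAt : ∀ {V} → Tree V → Path → V → Set
LeafAt T p x = subtree T p ≡ just (leaf x)

-- Arc pattern between x (left) and y (right) forced by the label of
-- lca(x,y); the arguments are [ (x,y) is an arc ] and [ (y,x) is an arc ].
LabelArcs : Label → Bool → Bool → Set
LabelArcs lab0  a b = a ≡ false × b ≡ false
LabelArcs lab1  a b = a ≡ true  × b ≡ true
LabelArcs lab1→ a b = a ≡ true  × b ≡ false

record IsCotree {n : ℕ} (G : Digraph n) (T : Tree (Fin n)) : Set where
  field
    -- every inner vertex has at least 2 children (root degree ≥ 2,
    -- other inner vertices degree ≥ 3)
    branching : ∀ p l ts → InnerAt T p l ts → 2 ≤ length ts
    alternating : ∀ p i l ts l' ts' →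
      InnerAt T p l ts → InnerAt T (p ++ [ i ]) l' ts' → l ≢ l'
    leaf-exists : ∀ x → ∃[ p ] LeafAt T p x
    leaf-unique : ∀ x p q → LeafAt T p x → LeafAt T q x → p ≡ q
    -- for leaves x, y whose lca is the inner vertex at p, with x in the
    -- i-th and y in the j-th child subtree and i < j (x left of y),
    -- the label of the lca determines the arcs between x and y
    lca-arcs : ∀ p l ts i j a b x y →
      InnerAt T p l ts → LeafAt T (p ++ i ∷ a) x → LeafAt T (p ++ j ∷ b) y →
      i < j → LabelArcs l (arc G x y) (arc G y x)

-- Right-hand side of the lemma: inner vertices v ≻ w (w = p ++ k ∷ r lies
-- in the subtree of the k-th child of v = p) such that (i) or (ii) holds.
ForbiddenPair : ∀ {V} → Tree V → Set
ForbiddenPair T =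
  ∃[ p ] ∃[ k ] ∃[ r ] ∃[ lv ] ∃[ tsv ] ∃[ lw ] ∃[ tsw ]
    (InnerAt T p lv tsv × InnerAt T (p ++ k ∷ r) lw tsw ×
      ((lv ≡ lab0 × lw ≢ lab0) ⊎
       (lv ≡ lab1→ × lw ≡ lab1 × suc k < length tsv)))

module Submission where

-- For x ≠ y the label of lca(x,y) is determined by the arcs between x and y
-- (0: none, 1: both, →1: one); call it the pair label.  Each of F₁, F₅, F₈
-- has the shape: z relates to x and to y alike, while x, y relate otherwise.
--
-- Forward: let w = lca(x,y).  If z lay below w, then w would also be
-- lca(x,z) or lca(y,z) and carry two different pair labels.  So z branches
-- off at a proper ancestor v = lca(x,z) of w, and (label v, label w) is
-- (0, ≠0) for F₁, F₅ and (→1, 1) for F₈, where the arc x → z puts w left of z.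
-- Backward: leaves x, y below the first two children of w and a leaf z below
-- another child of v (in case (ii) the next one to the right) have all six
-- arcs fixed by the cotree axioms, giving F₅ / F₁ in case (i), F₈ in (ii).

open import Defs
open import Data.Nat using (ℕ; zero; suc; _<_; _≤_; z≤n; s≤s; _≟_)
open import Data.Nat.Properties using (<-cmp; ≤-trans; ≤-<-trans; n<1+n)
open import Data.Fin using (Fin; zero; suc)
open import Data.Bool using (Bool; true; false)
open import Data.List using (List; []; _∷_; _++_; [_]; length)
open import Data.List.Properties using (++-assoc; ++-identityʳ; ++-cancelˡ; ∷-injectiveˡ)
open import Data.Maybe using (just; nothing; _>>=_)
open import Data.Product using (_×_; ∃-syntax; _,_; proj₁; proj₂)
open import Data.Sum using (_⊎_; inj₁; inj₂; map₂)
open import Data.Empty using (⊥; ⊥-elim)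
open import Function using (_∘_)
open import Function.Definitions using (Injective)
open import Relation.Binary.PropositionalEquality using (_≡_; _≢_; refl; sym; trans; cong; cong₂; subst)
open import Relation.Binary.Definitions using (tri<; tri≈; tri>)
open import Relation.Nullary using (yes; no)

mutual
  subtree-++ : ∀ {V} (t : Tree V) p q → subtree t (p ++ q) ≡ (subtree t p >>= λ s → subtree s q)
  subtree-++ t [] q = refl
  subtree-++ (leaf x) (i ∷ p) q = refl
  subtree-++ (node l ts) (i ∷ p) q = subtreeL-++ ts i p q

  subtreeL-++ : ∀ {V} (ts : List (Tree V)) i p q →
    subtreeL ts i (p ++ q) ≡ (subtreeL ts i p >>= λ s → subtree s q)
  subtreeL-++ [] i p q = refl
  subtreeL-++ (t ∷ ts) zero p q = subtree-++ t p q
  subtreeL-++ (t ∷ ts) (suc i) p q = subtreeL-++ ts i p q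

subtree-descend : ∀ {V} (T : Tree V) p q {s} → subtree T p ≡ just s → subtree T (p ++ q) ≡ subtree s q
subtree-descend T p q e rewrite subtree-++ T p q | e = refl

subtreeL-index : ∀ {V} (ts : List (Tree V)) i a {u} → subtreeL ts i a ≡ just u → i < length ts
subtreeL-index [] i a ()
subtreeL-index (t ∷ ts) zero a e = s≤s z≤n
subtreeL-index (t ∷ ts) (suc i) a e = s≤s (subtreeL-index ts i a e)

child-exists : ∀ {V} (ts : List (Tree V)) {i} → i < length ts → ∃[ t ] subtreeL ts i [] ≡ just t
child-exists (t ∷ ts) {zero} _ = t , refl
child-exists (t ∷ ts) {suc i} (s≤s i<len) = child-exists ts i<len

child-index-bound : ∀ {V} (T : Tree V) {p l ts i a u} →
  InnerAt T p l ts → subtree T (p ++ i ∷ a) ≡ just u → i < length ts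
child-index-bound T {p} {ts = ts} {i} {a} inner h =
  subtreeL-index ts i a (trans (sym (subtree-descend T p (i ∷ a) inner)) h)

parent-inner : ∀ {V} (T : Tree V) p i a {u} → subtree T (p ++ i ∷ a) ≡ just u →
  ∃[ l ] ∃[ ts ] InnerAt T p l ts
parent-inner T p i a {u} h = node-of (subtree T p) refl (trans (sym (subtree-++ T p (i ∷ a))) h)
  where
  node-of : ∀ m → subtree T p ≡ m → (m >>= λ s → subtree s (i ∷ a)) ≡ just u →
    ∃[ l ] ∃[ ts ] InnerAt T p l ts
  node-of (just (node l ts)) e _ = l , ts , e
  node-of (just (leaf x)) e ()
  node-of nothing e ()

leaf-childless : ∀ {V} (T : Tree V) P {x} e r {s} → LeafAt T P x → subtree T (P ++ e ∷ r) ≢ just s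
leaf-childless T P e r hx h with trans (sym (subtree-descend T P (e ∷ r) hx)) h
... | ()

leaf-not-inner : ∀ {V} (T : Tree V) P {x l ts} → LeafAt T P x → InnerAt T P l ts → ⊥
leaf-not-inner T P hx inner with trans (sym hx) inner
... | ()

leaf-label-unique : ∀ {V} (T : Tree V) P {x y : V} → LeafAt T P x → LeafAt T P y → x ≡ y
leaf-label-unique T P hx hy with trans (sym hx) hy
... | refl = refl

data Relative (P Q : Path) : Set where
  equal          : P ≡ Q → Relative P Q
  strictly-below : ∀ e r → P ≡ Q ++ e ∷ r → Relative P Q
  strictly-above : ∀ e r → Q ≡ P ++ e ∷ r → Relative P Q
  diverge        : ∀ p i j a b → i ≢ j → P ≡ p ++ i ∷ a → Q ≡ p ++ j ∷ b → Relative P Q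

relative-∷ : ∀ k {P Q} → Relative P Q → Relative (k ∷ P) (k ∷ Q)
relative-∷ k (equal e) = equal (cong (k ∷_) e)
relative-∷ k (strictly-below e r eq) = strictly-below e r (cong (k ∷_) eq)
relative-∷ k (strictly-above e r eq) = strictly-above e r (cong (k ∷_) eq)
relative-∷ k (diverge p i j a b i≢j eP eQ) = diverge (k ∷ p) i j a b i≢j (cong (k ∷_) eP) (cong (k ∷_) eQ)

relative : ∀ P Q → Relative P Q
relative [] [] = equal refl
relative [] (e ∷ r) = strictly-above e r refl
relative (e ∷ r) [] = strictly-below e r refl
relative (i ∷ P) (j ∷ Q) with i ≟ j
... | yes refl = relative-∷ i (relative P Q)
... | no i≢j = diverge [] i j P Q i≢j refl refl

arcLabel : Bool → Bool → Label
arcLabel false false = lab0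
arcLabel true  true  = lab1
arcLabel true  false = lab1→
arcLabel false true  = lab1→

arcLabel-sym : ∀ a b → arcLabel a b ≡ arcLabel b a
arcLabel-sym false false = refl
arcLabel-sym false true  = refl
arcLabel-sym true  false = refl
arcLabel-sym true  true  = refl

LabelArcs⇒arcLabel : ∀ {l a b} → LabelArcs l a b → arcLabel a b ≡ l
LabelArcs⇒arcLabel {lab0}  (refl , refl) = refl
LabelArcs⇒arcLabel {lab1}  (refl , refl) = refl
LabelArcs⇒arcLabel {lab1→} (refl , refl) = refl

arcLabel-lab0 : ∀ {a b} → arcLabel a b ≡ lab0 → a ≡ false × b ≡ false
arcLabel-lab0 {false} {false} refl = refl , refl
arcLabel-lab0 {false} {true}  ()
arcLabel-lab0 {true}  {false} ()
arcLabel-lab0 {true}  {true}  ()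

pairLabel : ∀ {A : Set} → (A → A → Bool) → A → A → Label
pairLabel arc x y = arcLabel (arc x y) (arc y x)

X Y Z : Fin 3
X = zero
Y = suc zero
Z = suc (suc zero)

induced-label : ∀ {n} (G : Digraph n) {F : Digraph3} ((f , _ , f-arcs) : ContainsInduced G F) →
  ∀ u v → u ≢ v → pairLabel (arc G) (f u) (f v) ≡ pairLabel F u v
induced-label G (f , _ , f-arcs) u v u≢v = cong₂ arcLabel (f-arcs u v u≢v) (f-arcs v u (u≢v ∘ sym))

triangle : ∀ {n} → Fin n → Fin n → Fin n → Fin 3 → Fin n
triangle x y z zero = x
triangle x y z (suc zero) = y
triangle x y z (suc (suc zero)) = z

induced-triangle : ∀ {n} {G : Digraph n} {F : Digraph3} {x y z : Fin n} →
  x ≢ y → x ≢ z → y ≢ z →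
  arc G x y ≡ F X Y → arc G y x ≡ F Y X → arc G x z ≡ F X Z →
  arc G z x ≡ F Z X → arc G y z ≡ F Y Z → arc G z y ≡ F Z Y → ContainsInduced G F
induced-triangle {G = G} {F} {x} {y} {z} x≢y x≢z y≢z xy yx xz zx yz zy = triangle x y z , injective , arcs
  where
  injective : Injective _≡_ _≡_ (triangle x y z)
  injective {zero} {zero} _ = refl
  injective {zero} {suc zero} e = ⊥-elim (x≢y e)
  injective {zero} {suc (suc zero)} e = ⊥-elim (x≢z e)
  injective {suc zero} {zero} e = ⊥-elim (x≢y (sym e))
  injective {suc zero} {suc zero} _ = refl
  injective {suc zero} {suc (suc zero)} e = ⊥-elim (y≢z e)
  injective {suc (suc zero)} {zero} e = ⊥-elim (x≢z (sym e))
  injective {suc (suc zero)} {suc zero} e = ⊥-elim (y≢z (sym e))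
  injective {suc (suc zero)} {suc (suc zero)} _ = refl

  arcs : ∀ u v → u ≢ v → arc G (triangle x y z u) (triangle x y z v) ≡ F u v
  arcs zero zero u≢v = ⊥-elim (u≢v refl)
  arcs zero (suc zero) _ = xy
  arcs zero (suc (suc zero)) _ = xz
  arcs (suc zero) zero _ = yx
  arcs (suc zero) (suc zero) u≢v = ⊥-elim (u≢v refl)
  arcs (suc zero) (suc (suc zero)) _ = yz
  arcs (suc (suc zero)) zero _ = zx
  arcs (suc (suc zero)) (suc zero) _ = zy
  arcs (suc (suc zero)) (suc (suc zero)) u≢v = ⊥-elim (u≢v refl)

other-child : ∀ k {len} → 2 ≤ len → ∃[ m ] k ≢ m × m < len
other-child zero    2≤len = 1 , (λ ()) , 2≤len
other-child (suc k) 2≤len = 0 , (λ ()) , ≤-trans (s≤s z≤n) 2≤len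

module CotreeFacts {n} (G : Digraph n) (T : Tree (Fin n)) (cotree : IsCotree G T) where
  open IsCotree cotree

  record Below (p : Path) (i : ℕ) (x : Fin n) : Set where
    constructor below
    field
      rest    : Path
      leaf-at : LeafAt T (p ++ i ∷ rest) x

  -- p is lca(x,y): x and y lie below distinct children of p.
  Separates : Path → Fin n → Fin n → Set
  Separates p x y = ∃[ i ] ∃[ j ] i ≢ j × Below p i x × Below p j y

  below-ancestor : ∀ {q k r i x} → Below (q ++ k ∷ r) i x → Below q k x
  below-ancestor {q} {k} {r} {i} {x} (below a h) =
    below (r ++ i ∷ a) (subst (λ P → LeafAt T P x) (++-assoc q (k ∷ r) (i ∷ a)) h)

  separated-distinct : ∀ {p i j x y} → Below p i x → Below p j y → i ≢ j → x ≢ y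
  separated-distinct {p} {x = x} (below a hx) (below b hy) i≢j refl =
    i≢j (∷-injectiveˡ (++-cancelˡ p _ _ (leaf-unique x _ _ hx hy)))

  leaf-below : ∀ p s → subtree T p ≡ just s → ∃[ q ] ∃[ x ] LeafAt T (p ++ q) x
  leaf-below p (leaf x) e = [] , x , subst (λ P → LeafAt T P x) (sym (++-identityʳ p)) e
  leaf-below p (node l []) e with branching p l [] e
  ... | ()
  leaf-below p (node l (t ∷ _)) e with leaf-below (p ++ [ 0 ]) t (subtree-descend T p [ 0 ] e)
  ... | q , x , h = 0 ∷ q , x , subst (λ P → LeafAt T P x) (++-assoc p [ 0 ] q) h

  child-leaf : ∀ p {l ts i} → InnerAt T p l ts → i < length ts → ∃[ x ] Below p i x
  child-leaf p {ts = ts} {i} inner i<len with child-exists ts i<len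
  ... | t , e with leaf-below (p ++ [ i ]) t (trans (subtree-descend T p [ i ] inner) e)
  ... | q , x , h = x , below q (subst (λ P → LeafAt T P x) (++-assoc p [ i ] q) h)

  lca-exists : ∀ {x y} → x ≢ y → ∃[ p ] Separates p x y
  lca-exists {x} {y} x≢y with leaf-exists x | leaf-exists y
  ... | P , hx | Q , hy with relative P Q
  ... | equal refl = ⊥-elim (x≢y (leaf-label-unique T P hx hy))
  ... | strictly-below e r refl = ⊥-elim (leaf-childless T Q e r hy hx)
  ... | strictly-above e r refl = ⊥-elim (leaf-childless T P e r hx hy)
  ... | diverge p i j a b i≢j refl refl = p , i , j , i≢j , below a hx , below b hy

  leaf-position : ∀ {p l ts P z} → InnerAt T p l ts → LeafAt T P z →
    (∃[ m ] Below p m z) ⊎ (∃[ q ] ∃[ k ] ∃[ r ] ∃[ m ] k ≢ m × p ≡ q ++ k ∷ r × Below q m z)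
  leaf-position {p} {P = P} inner hz with relative P p
  ... | equal refl = ⊥-elim (leaf-not-inner T P hz inner)
  ... | strictly-below m c refl = inj₁ (m , below c hz)
  ... | strictly-above e r refl = ⊥-elim (leaf-childless T P e r hz inner)
  ... | diverge q m k c r m≢k refl refl = inj₂ (q , k , r , m , m≢k ∘ sym , refl , below c hz)

  ordered-arcs : ∀ {p l ts i j x y} → InnerAt T p l ts → Below p i x → Below p j y → i < j →
    LabelArcs l (arc G x y) (arc G y x)
  ordered-arcs {p} {l} {ts} {i} {j} {x} {y} inner (below a hx) (below b hy) i<j =
    lca-arcs p l ts i j a b x y inner hx hy i<j

  lca-label : ∀ {p l ts x y} → InnerAt T p l ts → Separates p x y → l ≡ pairLabel (arc G) x y
  lca-label {x = x} {y} inner (i , j , i≢j , x∈i , y∈j) with <-cmp i j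
  ... | tri< i<j _ _ = sym (LabelArcs⇒arcLabel (ordered-arcs inner x∈i y∈j i<j))
  ... | tri≈ _ i≡j _ = ⊥-elim (i≢j i≡j)
  ... | tri> _ _ j<i = trans (sym (LabelArcs⇒arcLabel (ordered-arcs inner y∈j x∈i j<i)))
                             (arcLabel-sym (arc G y x) (arc G x y))

  lca-inner : ∀ {p x y} → Separates p x y → ∃[ ts ] InnerAt T p (pairLabel (arc G) x y) ts
  lca-inner {p} sep@(i , _ , _ , below a hx , _) with parent-inner T p i a hx
  ... | l , ts , inner = ts , subst (λ l → InnerAt T p l ts) (lca-label inner sep) inner

  lab1→-order : ∀ {p ts i j x y} → InnerAt T p lab1→ ts → Below p i x → Below p j y → i ≢ j →
    arc G x y ≡ true → i < j
  lab1→-order {i = i} {j} inner x∈i y∈j i≢j xy with <-cmp i j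
  ... | tri< i<j _ _ = i<j
  ... | tri≈ _ i≡j _ = ⊥-elim (i≢j i≡j)
  ... | tri> _ _ j<i with trans (sym xy) (proj₂ (ordered-arcs inner y∈j x∈i j<i))
  ...   | ()

  record Ancestry (lv lw : Label) (x z : Fin n) : Set where
    field
      v       : Path
      k m     : ℕ
      r       : Path
      tsv tsw : List (Tree (Fin n))
      v-inner : InnerAt T v lv tsv
      w-inner : InnerAt T (v ++ k ∷ r) lw tsw
      x-below : Below v k x
      z-below : Below v m z
      k≢m     : k ≢ m

  -- If z relates to x and y alike, but x and y relate differently, then z
  -- branches off strictly above w = lca(x,y): otherwise w would also be
  -- lca(x,z) or lca(y,z) and carry two different labels.
  above-lca : ∀ {x y z lv lw} → x ≢ y →
    pairLabel (arc G) x y ≡ lw → pairLabel (arc G) x z ≡ lv → pairLabel (arc G) y z ≡ lv →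
    lw ≢ lv → Ancestry lv lw x z
  above-lca {x} {y} {z} {lv} x≢y xy xz yz lw≢lv with lca-exists x≢y
  ... | p , i , j , i≢j , x∈i , y∈j with lca-inner (i , j , i≢j , x∈i , y∈j) | leaf-exists z
  ... | tsw , w-inner | Pz , hz with leaf-position {P = Pz} w-inner hz
  ... | inj₁ (m , z∈m) = ⊥-elim (lw≢lv (trans (sym xy) (w-label-is-lv m z∈m)))
    where
    w-label-is-lv : ∀ m → Below p m z → pairLabel (arc G) x y ≡ lv
    w-label-is-lv m z∈m with m ≟ i
    ... | yes refl = trans (lca-label w-inner (j , m , i≢j ∘ sym , y∈j , z∈m)) yz
    ... | no m≢i = trans (lca-label w-inner (i , m , m≢i ∘ sym , x∈i , z∈m)) xz
  ... | inj₂ (q , k , r , m , k≢m , refl , z∈m) with lca-inner (k , m , k≢m , below-ancestor x∈i , z∈m)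
  ... | tsv , v-inner = record
    { v = q ; k = k ; m = m ; r = r ; tsv = tsv ; tsw = tsw
    ; v-inner = subst (λ l → InnerAt T q l tsv) xz v-inner
    ; w-inner = subst (λ l → InnerAt T (q ++ k ∷ r) l tsw) xy w-inner
    ; x-below = below-ancestor x∈i ; z-below = z∈m ; k≢m = k≢m }

  forbidden-0 : ∀ {lw x z} → Ancestry lab0 lw x z → lw ≢ lab0 → ForbiddenPair T
  forbidden-0 {lw} anc lw≢0 = v , k , r , lab0 , tsv , lw , tsw , v-inner , w-inner , inj₁ (refl , lw≢0)
    where open Ancestry anc

  -- Case (ii): the arc x → z puts the child containing w left of that of z.
  forbidden-1→ : ∀ {x z} → Ancestry lab1→ lab1 x z → arc G x z ≡ true → ForbiddenPair T
  forbidden-1→ anc xz =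
    v , k , r , lab1→ , tsv , lab1 , tsw , v-inner , w-inner , inj₂ (refl , refl , ≤-<-trans k<m m<len)
    where
    open Ancestry anc
    k<m : k < m
    k<m = lab1→-order v-inner x-below z-below k≢m xz
    m<len : m < length tsv
    m<len = child-index-bound T {p = v} v-inner (Below.leaf-at z-below)

  triangle-ancestry : ∀ {F} (F⊆G : ContainsInduced G F) →
    pairLabel F Y Z ≡ pairLabel F X Z → pairLabel F X Y ≢ pairLabel F X Z →
    Ancestry (pairLabel F X Z) (pairLabel F X Y) (proj₁ F⊆G X) (proj₁ F⊆G Z)
  triangle-ancestry F⊆G@(f , f-inj , _) yz≡xz xy≢xz =
    above-lca (λ e → X≢Y (f-inj e))
      (induced-label G F⊆G X Y (λ ())) (induced-label G F⊆G X Z (λ ()))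
      (trans (induced-label G F⊆G Y Z (λ ())) yz≡xz) xy≢xz
    where
    X≢Y : X ≢ Y
    X≢Y ()

  forward : ContainsInduced G F₁ ⊎ ContainsInduced G F₅ ⊎ ContainsInduced G F₈ → ForbiddenPair T
  forward (inj₁ F₁⊆G) = forbidden-0 (triangle-ancestry F₁⊆G refl (λ ())) (λ ())
  forward (inj₂ (inj₁ F₅⊆G)) = forbidden-0 (triangle-ancestry F₅⊆G refl (λ ())) (λ ())
  forward (inj₂ (inj₂ F₈⊆G@(_ , _ , f-arcs))) =
    forbidden-1→ (triangle-ancestry F₈⊆G refl (λ ())) (f-arcs X Z (λ ()))

  cherry : ∀ w {l ts} → InnerAt T w l ts → ∃[ x ] ∃[ y ] Below w 0 x × Below w 1 y
  cherry w {l} {ts} inner =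
    let 2≤len = branching w l ts inner
        (x , x∈0) = child-leaf w inner (≤-trans (s≤s z≤n) 2≤len)
        (y , y∈1) = child-leaf w inner 2≤len
    in x , y , x∈0 , y∈1

  backward-0 : ∀ p k r {tsv lw tsw} → InnerAt T p lab0 tsv → InnerAt T (p ++ k ∷ r) lw tsw →
    lw ≢ lab0 → ContainsInduced G F₁ ⊎ ContainsInduced G F₅
  backward-0 p k r {tsv} v-inner w-inner lw≢0
    with cherry (p ++ k ∷ r) w-inner | other-child k (branching p lab0 tsv v-inner)
  ... | x , y , x∈0 , y∈1 | m , k≢m , m<len with child-leaf p v-inner m<len
  ... | z , z∈m = by-label lw≢0 (ordered-arcs w-inner x∈0 y∈1 (s≤s z≤n))
    where
    x∈k : Below p k x
    x∈k = below-ancestor x∈0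
    y∈k : Below p k y
    y∈k = below-ancestor y∈1
    x≢y : x ≢ y
    x≢y = separated-distinct x∈0 y∈1 (λ ())
    x≢z : x ≢ z
    x≢z = separated-distinct x∈k z∈m k≢m
    y≢z : y ≢ z
    y≢z = separated-distinct y∈k z∈m k≢m
    -- v = lca(x,z) = lca(y,z) is labelled 0, so z is isolated from x and y.
    xz : arc G x z ≡ false × arc G z x ≡ false
    xz = arcLabel-lab0 (sym (lca-label v-inner (k , m , k≢m , x∈k , z∈m)))
    yz : arc G y z ≡ false × arc G z y ≡ false
    yz = arcLabel-lab0 (sym (lca-label v-inner (k , m , k≢m , y∈k , z∈m)))
    by-label : ∀ {l} → l ≢ lab0 → LabelArcs l (arc G x y) (arc G y x) →
      ContainsInduced G F₁ ⊎ ContainsInduced G F₅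
    by-label {lab0} l≢0 _ = ⊥-elim (l≢0 refl)
    by-label {lab1} _ (xy , yx) =
      inj₂ (induced-triangle x≢y x≢z y≢z xy yx (proj₁ xz) (proj₂ xz) (proj₁ yz) (proj₂ yz))
    by-label {lab1→} _ (xy , yx) =
      inj₁ (induced-triangle x≢y x≢z y≢z xy yx (proj₁ xz) (proj₂ xz) (proj₁ yz) (proj₂ yz))

  backward-1→ : ∀ p k r {tsv tsw} → InnerAt T p lab1→ tsv → InnerAt T (p ++ k ∷ r) lab1 tsw →
    suc k < length tsv → ContainsInduced G F₈
  backward-1→ p k r v-inner w-inner k+1<len
    with cherry (p ++ k ∷ r) w-inner | child-leaf p v-inner k+1<len
  ... | x , y , x∈0 , y∈1 | z , z∈k+1 =
    induced-triangle x≢y x≢z y≢z (proj₁ xy) (proj₂ xy) (proj₁ xz) (proj₂ xz) (proj₁ yz) (proj₂ yz)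
    where
    x∈k : Below p k x
    x∈k = below-ancestor x∈0
    y∈k : Below p k y
    y∈k = below-ancestor y∈1
    k≢k+1 : k ≢ suc k
    k≢k+1 ()
    x≢y : x ≢ y
    x≢y = separated-distinct x∈0 y∈1 (λ ())
    x≢z : x ≢ z
    x≢z = separated-distinct x∈k z∈k+1 k≢k+1
    y≢z : y ≢ z
    y≢z = separated-distinct y∈k z∈k+1 k≢k+1
    xy : LabelArcs lab1 (arc G x y) (arc G y x)
    xy = ordered-arcs w-inner x∈0 y∈1 (s≤s z≤n)
    xz : LabelArcs lab1→ (arc G x z) (arc G z x)
    xz = ordered-arcs v-inner x∈k z∈k+1 (n<1+n k)
    yz : LabelArcs lab1→ (arc G y z) (arc G z y)
    yz = ordered-arcs v-inner y∈k z∈k+1 (n<1+n k)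

  backward : ForbiddenPair T → ContainsInduced G F₁ ⊎ ContainsInduced G F₅ ⊎ ContainsInduced G F₈
  backward (p , k , r , _ , _ , _ , _ , v-inner , w-inner , inj₁ (refl , lw≢0)) =
    map₂ inj₁ (backward-0 p k r v-inner w-inner lw≢0)
  backward (p , k , r , _ , _ , _ , _ , v-inner , w-inner , inj₂ (refl , refl , k+1<len)) =
    inj₂ (inj₂ (backward-1→ p k r v-inner w-inner k+1<len))

lemma17 : ∀ {n} (G : Digraph n) (T : Tree (Fin n)) → IsCotree G T →
    ((ContainsInduced G F₁ ⊎ ContainsInduced G F₅ ⊎ ContainsInduced G F₈) → ForbiddenPair T) ×
    (ForbiddenPair T → (ContainsInduced G F₁ ⊎ ContainsInduced G F₅ ⊎ ContainsInduced G F₈))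
lemma17 G T cotree = forward , backward
  where open CotreeFacts G T cotree
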